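{- Let $P \in \mathcal{C}(G_n)$, and let $j$, $k \in Q_n$ with $j \neq k$. If $Q_n - \{j\} \in\mathrm{char}(P)$, then $Q_n-\{k\} \notin\mathrm{char}(P)$.
   Context: Let $Q_n=\{1,\dots,n\}$ be a set of $n$ yes/no questions; an outcome on $S\subseteq Q_n$ is an element of $\{0,1\}^{|S|}$, and $X_S$ is the set of outcomes on $S$. A preference matrix on $Q_n$ is a $2^n\times n$ 0-1 matrix whose rows are the $2^n$ outcomes, each exactly once, ordered from most to least preferred. For a nonempty proper $S\subset Q_n$ and outcome $x$ on $Q_n-S$, $P^{[Q_n-S,x]}$ is the submatrix formed by the columns in $S$ and rows with outcome $x$ on $Q_n-S$ (in order); $S$ is separable with respect to $P$ if $P^{[Q_n-S,x]}=P^{[Q_n-S,y]}$ for all $x,y\in X_{Q_n-S}$; $\emptyset$ and $Q_n$ are always separable. The character $\mathrm{char}(P)$ is the set of all subsets of $Q_n$ separable with respect to $P$. $\mathcal{C}(G_n)$ is the set of preference matrices generated by Hamiltonian paths in the $n$-dimensional hypercube graph $G_n$ with Gray code labeling, i.e. preference matrices in which consecutive rows differ in exactly one entry. -}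

module Defs where

open import Data.Nat using (ℕ)
open import Data.Bool using (Bool; true; false; _∧_; _∨_; if_then_else_)
open import Data.Bool.Properties using () renaming (_≟_ to _≟ᵇ_)
open import Data.Fin using (Fin)
open import Data.Fin.Subset using (Subset; Side; inside; outside; ⊥; ⊤)
open import Data.Vec using (Vec; lookup; tabulate)
open import Data.List using (List; filterᵇ; map; foldr; allFin)
open import Data.List.Membership.Propositional using (_∈_)
open import Data.List.Relation.Unary.Unique.Propositional using (Unique)
open import Data.List.Relation.Unary.Linked using (Linked)
open import Data.Product using (Σ; _×_)
open import Data.Sum using (_⊎_)
open import Relation.Binary.PropositionalEquality using (_≡_; _≢_)
open import Relation.Nullary using (does)

-- An outcome on Q_n: a 0-1 row of length n (false = 0, true = 1).
Outcome : ℕ → Set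
Outcome n = Vec Bool n

-- A preference matrix on Q_n: the list of rows (most to least preferred),
-- each of the 2^n outcomes occurring exactly once.
IsPreferenceMatrix : (n : ℕ) → List (Outcome n) → Set
IsPreferenceMatrix n P = Unique P × (∀ (v : Outcome n) → v ∈ P)

DifferInExactlyOne : {n : ℕ} → Outcome n → Outcome n → Set
DifferInExactlyOne {n} u v =
  Σ (Fin n) λ i → (lookup u i ≢ lookup v i) × (∀ k → k ≢ i → lookup u k ≡ lookup v k)

InC : (n : ℕ) → List (Outcome n) → Set
InC n P = IsPreferenceMatrix n P × Linked DifferInExactlyOne P

private
  allFinL : (n : ℕ) → List (Fin n)
  allFinL n = allFin n

  allB : {A : Set} → (A → Bool) → List A → Bool
  allB p = foldr (λ x b → p x ∧ b) true

  sideIn : Side → Bool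
  sideIn inside = true
  sideIn outside = false

agreesOutside : {n : ℕ} → Subset n → Outcome n → Outcome n → Bool
agreesOutside {n} S z r =
  allB (λ i → sideIn (lookup S i) ∨ does (lookup r i ≟ᵇ lookup z i)) (allFinL n)

-- Projection of a row onto the columns in S (columns outside S are blanked
-- to a constant, which does not affect equality of projections).
project : {n : ℕ} → Subset n → Outcome n → Outcome n
project S r = tabulate λ i → sideIn (lookup S i) ∧ lookup r i

-- P^{[Q_n - S, x]} where x is the restriction of z to Q_n - S.
subMatrix : {n : ℕ} → List (Outcome n) → Subset n → Outcome n → List (Outcome n)
subMatrix P S z = map (project S) (filterᵇ (agreesOutside S z) P)

-- S is separable w.r.t. P (∅ and Q_n are always separable).
-- Every outcome x on Q_n - S is the restriction of some z on Q_n.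
Separable : {n : ℕ} → List (Outcome n) → Subset n → Set
Separable {n} P S =
  (S ≡ ⊥) ⊎ (S ≡ ⊤) ⊎ (∀ (z w : Outcome n) → subMatrix P S z ≡ subMatrix P S w)

InChar : {n : ℕ} → List (Outcome n) → Subset n → Set
InChar P S = Separable P S

-- Let r₁ be the top row of P and c its j-th entry. If Q_n − {j} is separable, the rows with
-- j-th entry ¬c, projected off j, list the same vectors as those with j-th entry c, so the first
-- row r with j-th entry ¬c agrees with r₁ off j. The row just above r on the Gray path has j-th
-- entry c and differs from r only at j, hence agrees with r₁ everywhere; rows being distinct,
-- it is r₁ itself. So the second row of P is r₁ with entry j flipped. If Q_n − {k} were
-- separable as well, the second row would also be r₁ with entry k flipped, impossible for j ≠ k.
module Submission where

open import Defs
open import Data.Nat using (ℕ)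
open import Data.Fin using (Fin; zero; suc; _≟_)
open import Data.Fin.Subset using (Subset; inside; outside; ⊥; ⊤; ∁; ⁅_⁆; _∈_)
open import Data.Fin.Subset.Properties using (∈⊤; ∉⊥; x∈⁅x⁆; x≢y⇒x∉⁅y⁆; x∈p⇒x∉∁p; x∉p⇒x∈∁p)
open import Data.Bool using (Bool; true; false; not; _∧_; T)
open import Data.Bool.Properties using (∧-identityʳ; not-¬; ¬-not; not-involutive) renaming (_≟_ to _≟ᵇ_)
open import Data.Vec using (Vec; []; _∷_; lookup; replicate; _[_]%=_)
open import Data.Vec.Properties
  using ( ∷-injectiveˡ; ∷-injectiveʳ; []=⇒lookup; lookup⇒[]=; lookup-replicate
        ; lookup∘updateAt; lookup∘updateAt′; tabulate∘lookup; tabulate-cong )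
open import Data.List using (List; []; _∷_; map; foldr; filter; allFin)
import Data.List as List
open import Data.List.Properties using (filter-≐; filter-accept; filter-reject)
import Data.List.Properties as Listₚ
open import Data.List.Membership.Propositional using () renaming (_∈_ to _∈ˡ_)
open import Data.List.Relation.Unary.Any using (here; there)
open import Data.List.Relation.Unary.All as All using ()
open import Data.List.Relation.Unary.AllPairs using (AllPairs; _∷_)
open import Data.List.Relation.Unary.Linked as Linked using (Linked; _∷_)
open import Data.Product using (_×_; _,_; ∃-syntax)
open import Data.Sum using (_⊎_; inj₁; inj₂; [_,_])
open import Data.Empty using (⊥-elim)
open import Function using (_∘_; id; case_of_)
open import Relation.Binary.PropositionalEquality
  using (_≡_; _≢_; refl; sym; trans; cong; cong₂; subst; _≗_; module ≡-Reasoning)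
open import Relation.Nullary using (¬_; does; yes; no)
open import Relation.Nullary.Decidable using (isYes; isYes≗does; toWitness; fromWitness)

private variable
  n : ℕ

ConstantSubMatrix : List (Outcome n) → Subset n → Set
ConstantSubMatrix {n} P S = ∀ (z w : Outcome n) → subMatrix P S z ≡ subMatrix P S w

lookup-injective : {A : Set} {u v : Vec A n} → lookup u ≗ lookup v → u ≡ v
lookup-injective {u = u} {v} h =
  trans (sym (tabulate∘lookup u)) (trans (tabulate-cong h) (tabulate∘lookup v))

foldr-tabulate : ∀ {A B : Set} (f : A → B → B) e (g : Fin n → A) →
  foldr f e (List.tabulate g) ≡ foldr (f ∘ g) e (allFin n)
foldr-tabulate {n = ℕ.zero} f e g = refl
foldr-tabulate {n = ℕ.suc n} f e g =
  cong (f (g zero)) (trans (foldr-tabulate f e (g ∘ suc)) (sym (foldr-tabulate (f ∘ g) e suc)))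

≢⇒lookup-∁⁅⁆≡inside : {i j : Fin n} → i ≢ j → lookup (∁ ⁅ j ⁆) i ≡ inside
≢⇒lookup-∁⁅⁆≡inside i≢j = []=⇒lookup (x∉p⇒x∈∁p (x≢y⇒x∉⁅y⁆ i≢j))

lookup-∁⁅⁆≡inside⇒≢ : {i j : Fin n} → lookup (∁ ⁅ j ⁆) i ≡ inside → i ≢ j
lookup-∁⁅⁆≡inside⇒≢ {j = j} j∈∁⁅j⁆ refl = x∈p⇒x∉∁p (x∈⁅x⁆ j) (lookup⇒[]= j _ j∈∁⁅j⁆)

∁⁅⁆≢⊤ : (j : Fin n) → ∁ ⁅ j ⁆ ≢ ⊤
∁⁅⁆≢⊤ j ∁⁅j⁆≡⊤ = x∈p⇒x∉∁p (x∈⁅x⁆ j) (subst (j ∈_) (sym ∁⁅j⁆≡⊤) ∈⊤)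

∁⁅⁆≢⊥ : {j k : Fin n} → k ≢ j → ∁ ⁅ j ⁆ ≢ ⊥
∁⁅⁆≢⊥ k≢j ∁⁅j⁆≡⊥ = ∉⊥ (subst (_ ∈_) ∁⁅j⁆≡⊥ (x∉p⇒x∈∁p (x≢y⇒x∉⁅y⁆ k≢j)))

project-cong : (S : Subset n) (u v : Outcome n) →
  (∀ i → lookup S i ≡ inside → lookup u i ≡ lookup v i) → project S u ≡ project S v
project-cong [] [] [] h = refl
project-cong (inside ∷ S) (_ ∷ u) (_ ∷ v) h = cong₂ _∷_ (h zero refl) (project-cong S u v (h ∘ suc))
project-cong (outside ∷ S) (_ ∷ u) (_ ∷ v) h = cong (false ∷_) (project-cong S u v (h ∘ suc))

project-injective : (S : Subset n) (u v : Outcome n) → project S u ≡ project S v →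
  ∀ i → lookup S i ≡ inside → lookup u i ≡ lookup v i
project-injective (inside ∷ S) (_ ∷ u) (_ ∷ v) eq zero refl = ∷-injectiveˡ eq
project-injective (s ∷ S) (_ ∷ u) (_ ∷ v) eq (suc i) = project-injective S u v (∷-injectiveʳ eq) i

-- allFin (suc n) unfolds to zero ∷ tabulate suc, and the fold over tabulate suc is the test on the tails.
agreesOutside-inside∷ : (S : Subset n) (z r : Outcome n) (a b : Bool) →
  agreesOutside (inside ∷ S) (a ∷ z) (b ∷ r) ≡ agreesOutside S z r
agreesOutside-inside∷ {n} S z r a b = foldr-tabulate {n = n} _ true suc

agreesOutside-outside∷ : (S : Subset n) (z r : Outcome n) (a b : Bool) →
  agreesOutside (outside ∷ S) (a ∷ z) (b ∷ r) ≡ does (b ≟ᵇ a) ∧ agreesOutside S z r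
agreesOutside-outside∷ {n} S z r a b = cong (does (b ≟ᵇ a) ∧_) (foldr-tabulate {n = n} _ true suc)

agreesOutside-∁⊥ : (z r : Outcome n) → agreesOutside (∁ ⊥) z r ≡ true
agreesOutside-∁⊥ [] [] = refl
agreesOutside-∁⊥ (a ∷ z) (b ∷ r) = trans (agreesOutside-inside∷ (∁ ⊥) z r a b) (agreesOutside-∁⊥ z r)

agreesOutside-∁⁅⁆ : (j : Fin n) (z r : Outcome n) →
  agreesOutside (∁ ⁅ j ⁆) z r ≡ does (lookup r j ≟ᵇ lookup z j)
agreesOutside-∁⁅⁆ zero (a ∷ z) (b ∷ r) = begin
  agreesOutside (outside ∷ ∁ ⊥) (a ∷ z) (b ∷ r) ≡⟨ agreesOutside-outside∷ (∁ ⊥) z r a b ⟩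
  does (b ≟ᵇ a) ∧ agreesOutside (∁ ⊥) z r       ≡⟨ cong (does (b ≟ᵇ a) ∧_) (agreesOutside-∁⊥ z r) ⟩
  does (b ≟ᵇ a) ∧ true                          ≡⟨ ∧-identityʳ _ ⟩
  does (b ≟ᵇ a)                                 ∎
  where open ≡-Reasoning
agreesOutside-∁⁅⁆ (suc j) (a ∷ z) (b ∷ r) =
  trans (agreesOutside-inside∷ (∁ ⁅ j ⁆) z r a b) (agreesOutside-∁⁅⁆ j z r)

updateAt-not-≢ : {j k : Fin n} (u : Outcome n) → j ≢ k → u [ j ]%= not ≢ u [ k ]%= not
updateAt-not-≢ {j = j} {k} u j≢k eq = not-¬ refl (begin
  lookup u j                  ≡⟨ sym (lookup∘updateAt′ j k j≢k u) ⟩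
  lookup (u [ k ]%= not) j    ≡⟨ cong (λ v → lookup v j) (sym eq) ⟩
  lookup (u [ j ]%= not) j    ≡⟨ lookup∘updateAt j u ⟩
  not (lookup u j)            ∎)
  where open ≡-Reasoning

module _ {n : ℕ} (j : Fin n) where

  rowsWith : Bool → List (Outcome n) → List (Outcome n)
  rowsWith b = filter (λ r → lookup r j ≟ᵇ b)

  projectOff : Outcome n → Outcome n
  projectOff = project (∁ ⁅ j ⁆)

  projectOff-cong : (u v : Outcome n) → (∀ i → i ≢ j → lookup u i ≡ lookup v i) →
    projectOff u ≡ projectOff v
  projectOff-cong u v h = project-cong (∁ ⁅ j ⁆) u v (λ i → h i ∘ lookup-∁⁅⁆≡inside⇒≢)

  projectOff-injective : (u v : Outcome n) → projectOff u ≡ projectOff v →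
    lookup u j ≡ lookup v j → u ≡ v
  projectOff-injective u v eq uⱼ≡vⱼ = lookup-injective λ i → case i ≟ j of λ where
    (yes refl) → uⱼ≡vⱼ
    (no i≢j)   → project-injective (∁ ⁅ j ⁆) u v eq i (≢⇒lookup-∁⁅⁆≡inside i≢j)

  projectOff-updateAt : (u : Outcome n) (f : Bool → Bool) →
    projectOff (u [ j ]%= f) ≡ projectOff u
  projectOff-updateAt u f = projectOff-cong (u [ j ]%= f) u (λ i i≢j → lookup∘updateAt′ i j i≢j u)

  projectOff-step : (u v : Outcome n) → DifferInExactlyOne u v → lookup u j ≢ lookup v j →
    projectOff u ≡ projectOff v
  projectOff-step u v (i , _ , agree) uⱼ≢vⱼ with i ≟ j
  ... | yes refl = projectOff-cong u v agree
  ... | no i≢j   = ⊥-elim (uⱼ≢vⱼ (agree j (i≢j ∘ sym)))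

  subMatrix-∁⁅⁆ : (P : List (Outcome n)) (z : Outcome n) →
    subMatrix P (∁ ⁅ j ⁆) z ≡ map projectOff (rowsWith (lookup z j) P)
  subMatrix-∁⁅⁆ P z = cong (map projectOff) (filter-≐ _ _ ((λ {r} → to {r}) , (λ {r} → from {r})) P)
    where
    agrees≡isYes : ∀ r → agreesOutside (∁ ⁅ j ⁆) z r ≡ isYes (lookup r j ≟ᵇ lookup z j)
    agrees≡isYes r = trans (agreesOutside-∁⁅⁆ j z r) (sym (isYes≗does _))
    to : ∀ {r} → T (agreesOutside (∁ ⁅ j ⁆) z r) → lookup r j ≡ lookup z j
    to {r} = toWitness ∘ subst T (agrees≡isYes r)
    from : ∀ {r} → lookup r j ≡ lookup z j → T (agreesOutside (∁ ⁅ j ⁆) z r)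
    from {r} = subst T (sym (agrees≡isYes r)) ∘ fromWitness

  rowsWith-separable : (P : List (Outcome n)) → ConstantSubMatrix P (∁ ⁅ j ⁆) →
    ∀ b b′ → map projectOff (rowsWith b P) ≡ map projectOff (rowsWith b′ P)
  rowsWith-separable P sep b b′ = begin
    map projectOff (rowsWith b P)       ≡⟨ sym (subMatrix-replicate b) ⟩
    subMatrix P (∁ ⁅ j ⁆) (replicate n b)  ≡⟨ sep (replicate n b) (replicate n b′) ⟩
    subMatrix P (∁ ⁅ j ⁆) (replicate n b′) ≡⟨ subMatrix-replicate b′ ⟩
    map projectOff (rowsWith b′ P)      ∎
    where
    open ≡-Reasoning
    subMatrix-replicate : ∀ c → subMatrix P (∁ ⁅ j ⁆) (replicate n c) ≡ map projectOff (rowsWith c P)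
    subMatrix-replicate c = trans (subMatrix-∁⁅⁆ P (replicate n c))
      (cong (λ c′ → map projectOff (rowsWith c′ P)) (lookup-replicate j c))

  first-change : ∀ {a L b r rs} → Linked DifferInExactlyOne (a ∷ L) → lookup a j ≢ b →
    rowsWith b L ≡ r ∷ rs →
    lookup r j ≡ b ×
      ((∃[ L′ ] L ≡ r ∷ L′) ⊎
       (∃[ y ] y ∈ˡ L × lookup y j ≢ b × projectOff y ≡ projectOff r))
  first-change {L = c ∷ L} {b} {r} (_ ∷ link) _ first with lookup c j ≟ᵇ b | first
  ... | yes cⱼ≡b | refl = cⱼ≡b , inj₁ (L , refl)
  ... | no cⱼ≢b | first′ with first-change link cⱼ≢b first′
  ...   | rⱼ≡b , inj₂ (y , y∈L , yⱼ≢b , y≈r) = rⱼ≡b , inj₂ (y , there y∈L , yⱼ≢b , y≈r)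
  ...   | rⱼ≡b , inj₁ (L′ , refl) =
          rⱼ≡b , inj₂ (c , here refl , cⱼ≢b , projectOff-step c r (Linked.head link) cⱼ≢rⱼ)
    where
    cⱼ≢rⱼ : lookup c j ≢ lookup r j
    cⱼ≢rⱼ cⱼ≡rⱼ = cⱼ≢b (trans cⱼ≡rⱼ rⱼ≡b)

  rowsWith-not-head : (r₁ : Outcome n) (L : List (Outcome n)) →
    ConstantSubMatrix (r₁ ∷ L) (∁ ⁅ j ⁆) →
    map projectOff (rowsWith (not (lookup r₁ j)) L) ≡
      projectOff r₁ ∷ map projectOff (rowsWith (lookup r₁ j) L)
  rowsWith-not-head r₁ L sep = begin
    map projectOff (rowsWith (not c) L)
      ≡⟨ cong (map projectOff) (sym (filter-reject (λ r → lookup r j ≟ᵇ not c) {r₁} {L} (not-¬ refl))) ⟩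
    map projectOff (rowsWith (not c) (r₁ ∷ L))
      ≡⟨ rowsWith-separable (r₁ ∷ L) sep (not c) c ⟩
    map projectOff (rowsWith c (r₁ ∷ L))
      ≡⟨ cong (map projectOff) (filter-accept (λ r → lookup r j ≟ᵇ c) {r₁} {L} refl) ⟩
    projectOff r₁ ∷ map projectOff (rowsWith c L) ∎
    where
    open ≡-Reasoning
    c : Bool
    c = lookup r₁ j

  second-row-flips : ∀ {r₁ L} → Linked DifferInExactlyOne (r₁ ∷ L) → AllPairs _≢_ (r₁ ∷ L) →
    ConstantSubMatrix (r₁ ∷ L) (∁ ⁅ j ⁆) →
    ∃[ L′ ] L ≡ r₁ [ j ]%= not ∷ L′
  second-row-flips {r₁} {L} link (r₁∉L ∷ _) sep
    with rowsWith (not (lookup r₁ j)) L in first | rowsWith-not-head r₁ L sep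
  ... | r ∷ _ | heads with first-change link (not-¬ refl) first
  ...   | rⱼ≡¬c , inj₁ (L′ , refl) = L′ , cong (_∷ L′) r≡flip
    where
    r≡flip : r ≡ r₁ [ j ]%= not
    r≡flip = projectOff-injective r (r₁ [ j ]%= not)
      (trans (Listₚ.∷-injectiveˡ heads) (sym (projectOff-updateAt r₁ not)))
      (trans rⱼ≡¬c (sym (lookup∘updateAt j r₁)))
  ...   | _ , inj₂ (y , y∈L , yⱼ≢¬c , y≈r) = ⊥-elim (All.lookup r₁∉L y∈L (sym y≡r₁))
    where
    y≡r₁ : y ≡ r₁
    y≡r₁ = projectOff-injective y r₁ (trans y≈r (Listₚ.∷-injectiveˡ heads))
      (trans (¬-not yⱼ≢¬c) (not-involutive (lookup r₁ j)))

separable-∁⁅⁆ : {P : List (Outcome n)} {j k : Fin n} → k ≢ j → InChar P (∁ ⁅ j ⁆) →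
  ConstantSubMatrix P (∁ ⁅ j ⁆)
separable-∁⁅⁆ k≢j = [ ⊥-elim ∘ ∁⁅⁆≢⊥ k≢j , [ ⊥-elim ∘ ∁⁅⁆≢⊤ _ , id ] ]

corollary4 : (n : ℕ) (P : List (Outcome n)) → InC n P →
    (j k : Fin n) → j ≢ k →
    InChar P (∁ ⁅ j ⁆) → ¬ InChar P (∁ ⁅ k ⁆)
corollary4 n [] ((_ , complete) , _) j k j≢k _ _ with complete (replicate n false)
... | ()
corollary4 n (r₁ ∷ L) ((distinct , _) , link) j k j≢k sepⱼ sepₖ
  with second-row-flips j link distinct (separable-∁⁅⁆ (j≢k ∘ sym) sepⱼ)
     | second-row-flips k link distinct (separable-∁⁅⁆ j≢k sepₖ)
... | L′ , refl | _ , flipⱼ≡flipₖ = updateAt-not-≢ r₁ j≢k (Listₚ.∷-injectiveˡ flipⱼ≡flipₖ)
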